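{- Let $N\ge 2$, $s\ge 1$, $1\le i\le s$, $2\le k\le N$, and consider the increasing prefixes $\sigma=[12\cdots(k-1)]$ and $\lambda_k(\sigma)=[12\cdots k]$. If $\lambda_k(\sigma)$ is type $i$-negative, then $\sigma$ is type $i$-negative.
   Context: Setting: $N$ applicants labeled $1,\dots,N$ by quality ($N$ best); interview order a uniformly random $\pi\in S_N$ revealed from the left, only relative orders observed; $s$ selections, each applicant irrevocably accepted (using a selection) or rejected; win if a selected applicant has value $N$. For $\pi$ of length $\ge k$, $\pi|_k$ is the relabelling of its first $k$ entries by relative order; $\pi\in S_N$ is $\sigma$-prefixed if $\pi|_{|\sigma|}=\sigma$; $Win(\sigma)$, $SD(\sigma)$: number of $\sigma$-prefixed $\pi\in S_N$ with $\pi(|\sigma|)=N$, resp. all $\sigma$-prefixed $\pi\in S_N$. For $\sigma$ of length $k$: $Q_1(\sigma)=Win(\sigma)/SD(\sigma)$; $Q_i(\sigma)$ = probability of winning by accepting applicant $k$ and playing optimally thereafter, conditioned on $\pi$ $\sigma$-prefixed and $i$ selections available when interviewing applicant $k$; $Q^o_i(\sigma)$ = probability of winning with the best strategy after deciding on applicant $k$, conditioned on $\pi$ $\sigma$-prefixed and $i$ selections still available right after interviewing applicant $k$. $\sigma$ is type $i$-positive if $Q_i(\sigma)\ge Q^o_i(\sigma)$ and type $i$-negative otherwise. -}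

module Defs where

open import Data.Bool using (Bool; true; false; if_then_else_; _∧_)
open import Data.Nat as ℕ using (ℕ; zero; suc; _∸_; _≡ᵇ_; _<ᵇ_; _≤ᵇ_)
open import Data.Integer using (+_)
open import Data.List using (List; []; _∷_; [_]; _++_; map; concatMap; upTo; take; drop; length; foldr)
open import Data.Rational using (ℚ; 0ℚ; _+_; _*_; _⊔_; _/_; _<_)

countᵇ : {A : Set} → (A → Bool) → List A → ℕ
countᵇ p [] = 0
countᵇ p (x ∷ xs) = if p x then suc (countᵇ p xs) else countᵇ p xs

eqL : List ℕ → List ℕ → Bool
eqL [] [] = true
eqL (x ∷ xs) (y ∷ ys) = (x ≡ᵇ y) ∧ eqL xs ys
eqL _ _ = false

-- Permutations in one-line notation: a permutation π ∈ S_N is the list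
-- [π(1), …, π(N)].  S_N = lists of length N with entries in {1..N},
-- pairwise distinct.
words : ℕ → ℕ → List (List ℕ)
words N zero = [ [] ]
words N (suc n) = concatMap (λ w → map (λ a → w ++ [ a ]) (map suc (upTo N))) (words N n)

distinct : List ℕ → Bool
distinct [] = true
distinct (x ∷ xs) = (countᵇ (λ y → y ≡ᵇ x) xs ≡ᵇ 0) ∧ distinct xs

filterB : {A : Set} → (A → Bool) → List A → List A
filterB p [] = []
filterB p (x ∷ xs) = if p x then x ∷ filterB p xs else filterB p xs

Sym : ℕ → List (List ℕ)
Sym N = filterB distinct (words N N)

restrict : ℕ → List ℕ → List ℕ
restrict k π = map (λ x → suc (countᵇ (λ y → y <ᵇ x) (take k π))) (take k π)

-- π is σ-prefixed (requires length π ≥ |σ|, automatic for π ∈ S_N, |σ| ≤ N)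
prefixed : List ℕ → List ℕ → Bool
prefixed σ π = (length σ ≤ᵇ length π) ∧ eqL (restrict (length σ) π) σ

-- π(k) = N  (positions are 1-based)
valueAtIs : ℕ → ℕ → List ℕ → Bool
valueAtIs k N π with drop (k ∸ 1) π
... | [] = false
... | x ∷ _ = x ≡ᵇ N

SD : ℕ → List ℕ → ℕ
SD N σ = countᵇ (prefixed σ) (Sym N)

Win : ℕ → List ℕ → ℕ
Win N σ = countᵇ (λ π → prefixed σ π ∧ valueAtIs (length σ) N π) (Sym N)

-- a / b as a rational (0 if b = 0; never used with b = 0 for genuine prefixes)
frac : ℕ → ℕ → ℚ
frac a zero = 0ℚ
frac a (suc b) = (+ a) / suc b

Q₁ : ℕ → List ℕ → ℚ
Q₁ N σ = frac (Win N σ) (SD N σ)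

-- The one-step extensions of a prefix σ of length k: the k+1 prefixes σ'
-- of length k+1 with σ'|_k = σ (new last entry has relative rank r ∈ {1..k+1}).
extend : List ℕ → ℕ → List ℕ
extend σ r = map (λ x → if r ≤ᵇ x then suc x else x) σ ++ [ r ]

extensions : List ℕ → List (List ℕ)
extensions σ = map (extend σ) (map suc (upTo (suc (length σ))))

sumℚ : List ℚ → ℚ
sumℚ = foldr _+_ 0ℚ

-- Optimal-play values (Bellman recursion), for N fixed.
-- f = number of applicants still to come after the current one (= N - |σ|).
-- cont N j f σ : probability (conditioned on π σ-prefixed) of selecting the
--   best applicant among applicants |σ|+1..N, playing optimally with j selections.
-- V N j f σ : value of optimally deciding on applicant |σ| with j selections.
-- Qacc N j f σ : win probability when accepting applicant |σ| (j ≥ 1 selections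
--   available) and playing optimally thereafter.
mutual
  cont : ℕ → ℕ → ℕ → List ℕ → ℚ
  cont N zero f σ = 0ℚ
  cont N (suc j) zero σ = 0ℚ
  cont N (suc j) (suc f) σ =
    sumℚ (map (λ σ' → frac (SD N σ') (SD N σ) * V N (suc j) f σ') (extensions σ))

  V : ℕ → ℕ → ℕ → List ℕ → ℚ
  V N zero f σ = 0ℚ
  V N (suc j) f σ = Qacc N (suc j) f σ ⊔ cont N (suc j) f σ

  Qacc : ℕ → ℕ → ℕ → List ℕ → ℚ
  Qacc N zero f σ = 0ℚ
  Qacc N (suc j) f σ = Q₁ N σ + cont N j f σ

Q : ℕ → ℕ → List ℕ → ℚ
Q N i σ = Qacc N i (N ∸ length σ) σ

Qᵒ : ℕ → ℕ → List ℕ → ℚ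
Qᵒ N i σ = cont N i (N ∸ length σ) σ

Negative : ℕ → ℕ → List ℕ → Set
Negative N i σ = Q N i σ < Qᵒ N i σ

incr : ℕ → List ℕ
incr k = map suc (upTo k)

-- A prefix pattern σ of length k is shared by exactly N!/k! permutations, whatever σ is, and if σ
-- ends in a new maximum then the best applicant is at position k in a fraction k/N of them.  Hence
-- the optimal values depend on a prefix only through its length: with j selections and f applicants
-- still to come, continuing is worth C_j(f) = continuation N j f, a Bellman average over the relative
-- rank of the next applicant.  For σ = [1..k-1], accepting is worth at most
-- (k-1)/N + 1/N + C_{i-1}(N-k) = Q_i([1..k]), which by hypothesis is below C_i(N-k); the same
-- hypothesis makes rejecting optimal for every rank of applicant k, so Q^o_i(σ) = C_i(N-k).
module Submission where

open import Defs
open import Algebra.Bundles using (Semiring; CommutativeRing)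
open import Data.List using (List; []; _∷_; [_]; _++_; _∷ʳ_; map; foldr; length)
open import Data.List.Membership.Propositional using (_∈_; _∉_)
open import Data.List.Relation.Unary.Any using (here; there)
open import Data.List.Relation.Unary.All using (All; []; _∷_)
import Data.List.Relation.Unary.All as All
open import Data.Product using (_×_; _,_; proj₁; proj₂; ∃-syntax)
open import Data.Empty using (⊥-elim)
open import Function using (_∘_)
open import Relation.Nullary using (¬_; Dec; yes; no)
open import Relation.Binary.PropositionalEquality as ≡ using (_≡_; _≢_; refl; sym; cong; cong₂; subst)

module ListSum {c ℓ} (R : Semiring c ℓ) where

  private
    module R = Semiring R
  open R using (Carrier; 0#; _≈_)
  open import Relation.Binary.Reasoning.Setoid R.setoid

  Σ : List Carrier → Carrier
  Σ = foldr R._+_ 0#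

  module _ {a} {A : Set a} where

    Σ-map-cong : ∀ {f g : A → Carrier} xs → (∀ {x} → x ∈ xs → f x ≈ g x) → Σ (map f xs) ≈ Σ (map g xs)
    Σ-map-cong [] _ = R.refl
    Σ-map-cong (x ∷ xs) f≈g = R.+-cong (f≈g (here ≡.refl)) (Σ-map-cong xs (f≈g ∘ there))

    Σ-map-++ : ∀ (f : A → Carrier) xs ys → Σ (map f (xs ++ ys)) ≈ Σ (map f xs) R.+ Σ (map f ys)
    Σ-map-++ f [] ys = R.sym (R.+-identityˡ _)
    Σ-map-++ f (x ∷ xs) ys = R.trans (R.+-congˡ (Σ-map-++ f xs ys)) (R.sym (R.+-assoc (f x) _ _))

    Σ-map-+ : ∀ (f g : A → Carrier) xs → Σ (map (λ x → f x R.+ g x) xs) ≈ Σ (map f xs) R.+ Σ (map g xs)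
    Σ-map-+ f g [] = R.sym (R.+-identityˡ 0#)
    Σ-map-+ f g (x ∷ xs) = begin
      (f x R.+ g x) R.+ Σ (map (λ x → f x R.+ g x) xs)  ≈⟨ R.+-congˡ (Σ-map-+ f g xs) ⟩
      (f x R.+ g x) R.+ (F R.+ G)                       ≈⟨ R.+-assoc (f x) (g x) _ ⟩
      f x R.+ (g x R.+ (F R.+ G))                       ≈⟨ R.+-congˡ (R.sym (R.+-assoc (g x) F G)) ⟩
      f x R.+ ((g x R.+ F) R.+ G)                       ≈⟨ R.+-congˡ (R.+-congʳ (R.+-comm (g x) F)) ⟩
      f x R.+ ((F R.+ g x) R.+ G)                       ≈⟨ R.+-congˡ (R.+-assoc F (g x) G) ⟩
      f x R.+ (F R.+ (g x R.+ G))                       ≈⟨ R.sym (R.+-assoc (f x) F _) ⟩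
      (f x R.+ F) R.+ (g x R.+ G)                       ∎
      where
      F = Σ (map f xs)
      G = Σ (map g xs)

    Σ-map-*ˡ : ∀ w (f : A → Carrier) xs → Σ (map (λ x → w R.* f x) xs) ≈ w R.* Σ (map f xs)
    Σ-map-*ˡ w f [] = R.sym (R.zeroʳ w)
    Σ-map-*ˡ w f (x ∷ xs) = R.trans (R.+-congˡ (Σ-map-*ˡ w f xs)) (R.sym (R.distribˡ w (f x) _))

    Σ-map-*ʳ : ∀ w (f : A → Carrier) xs → Σ (map (λ x → f x R.* w) xs) ≈ Σ (map f xs) R.* w
    Σ-map-*ʳ w f [] = R.sym (R.zeroˡ w)
    Σ-map-*ʳ w f (x ∷ xs) = R.trans (R.+-congˡ (Σ-map-*ʳ w f xs)) (R.sym (R.distribʳ w (f x) _))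

module Permutations where

  open import Data.Bool using (Bool; true; false; if_then_else_; _∧_; T)
  open import Data.Bool.Properties using (T-≡; ∧-assoc; ∧-identityʳ; ∧-zeroʳ; ⇔→≡)
  open import Data.Nat
  open import Data.Nat.Properties
  open import Data.Nat.ListAction using (sum)
  open import Data.List using (upTo; take; drop; concatMap; cartesianProductWith; initLast; _∷ʳ′_)
  open import Data.List.Properties
    using (∷ʳ-injective; length-map; length-upTo; length-take; length-++-sucʳ; map-++; map-∘; map-injective;
           map-cong-local; map-id-local; upTo-∷ʳ; take-all)
  open import Data.List.Membership.Propositional.Properties
    using (∈-map⁺; ∈-map⁻; ∈-upTo⁺; ∈-upTo⁻; ∈-++⁺ˡ; ∈-++⁺ʳ; ∈-++⁻; ∈-∃++; ∈-cartesianProductWith⁺; ∈-cartesianProductWith⁻)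
  open import Data.List.Membership.DecPropositional _≟_ using (_∈?_)
  open import Data.List.Membership.Propositional.Properties.WithK using (unique∧set⇒bag)
  import Data.List.Relation.Unary.All.Properties as All
  open import Data.List.Relation.Unary.Unique.Propositional using (Unique; []; _∷_)
  import Data.List.Relation.Unary.Unique.Propositional.Properties as Unique
  open import Data.List.Relation.Binary.Subset.Propositional using (_⊆_)
  open import Data.List.Relation.Binary.Permutation.Propositional using (_↭_; refl; prep; swap; trans)
  open import Data.List.Relation.Binary.BagAndSetEquality using (∼bag⇒↭)
  open import Data.Product using (map₁)
  open import Data.Sum using (inj₁; inj₂)
  open import Function.Bundles using (Equivalence; mk⇔)
  open import Relation.Binary using (tri<; tri≈; tri>)
  open import Algebra.Properties.CommutativeSemigroup *-commutativeSemigroup using (x∙yz≈y∙xz)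

  module ℕΣ = ListSum +-*-semiring

  private
    variable
      A B C : Set

  T⇒≡true : ∀ {b} → T b → b ≡ true
  T⇒≡true = Equivalence.to T-≡

  ≡true⇒T : ∀ {b} → b ≡ true → T b
  ≡true⇒T = Equivalence.from T-≡

  ¬T⇒≡false : ∀ {b} → ¬ T b → b ≡ false
  ¬T⇒≡false {false} _ = refl
  ¬T⇒≡false {true} ¬t = ⊥-elim (¬t _)

  ¬≡true⇒≡false : ∀ {b} → ¬ (b ≡ true) → b ≡ false
  ¬≡true⇒≡false {false} _ = refl
  ¬≡true⇒≡false {true} ¬t = ⊥-elim (¬t refl)

  ∧-true⁻ : ∀ {a b} → a ∧ b ≡ true → a ≡ true × b ≡ true
  ∧-true⁻ {true} b≡true = refl , b≡true

  ≡ᵇ-refl : ∀ n → (n ≡ᵇ n) ≡ true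
  ≡ᵇ-refl n = T⇒≡true (≡⇒≡ᵇ n n refl)

  ≡ᵇ-true⇒≡ : ∀ {m n} → (m ≡ᵇ n) ≡ true → m ≡ n
  ≡ᵇ-true⇒≡ {m} {n} = ≡ᵇ⇒≡ m n ∘ ≡true⇒T

  ≢⇒≡ᵇ-false : ∀ {m n} → m ≢ n → (m ≡ᵇ n) ≡ false
  ≢⇒≡ᵇ-false {m} {n} m≢n = ¬T⇒≡false (m≢n ∘ ≡ᵇ⇒≡ m n)

  ≡ᵇ-false⇒≢ : ∀ {m n} → (m ≡ᵇ n) ≡ false → m ≢ n
  ≡ᵇ-false⇒≢ {m} m≢ᵇn refl with () ← ≡.trans (sym (≡ᵇ-refl m)) m≢ᵇn

  <ᵇ-true⇒< : ∀ {m n} → (m <ᵇ n) ≡ true → m < n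
  <ᵇ-true⇒< {m} {n} = <ᵇ⇒< m n ∘ ≡true⇒T

  <⇒<ᵇ-true : ∀ {m n} → m < n → (m <ᵇ n) ≡ true
  <⇒<ᵇ-true = T⇒≡true ∘ <⇒<ᵇ

  ≥⇒<ᵇ-false : ∀ {m n} → n ≤ m → (m <ᵇ n) ≡ false
  ≥⇒<ᵇ-false {m} {n} n≤m = ¬T⇒≡false (λ m<ᵇn → <⇒≱ (<ᵇ⇒< m n m<ᵇn) n≤m)

  ≤⇒≤ᵇ-true : ∀ {m n} → m ≤ n → (m ≤ᵇ n) ≡ true
  ≤⇒≤ᵇ-true = T⇒≡true ∘ ≤⇒≤ᵇ

  >⇒≤ᵇ-false : ∀ {m n} → n < m → (m ≤ᵇ n) ≡ false
  >⇒≤ᵇ-false {m} {n} n<m = ¬T⇒≡false (λ m≤ᵇn → <⇒≱ n<m (≤ᵇ⇒≤ m n m≤ᵇn))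

  𝟙 : Bool → ℕ
  𝟙 true = 1
  𝟙 false = 0

  countᵇ-∷ : ∀ (p : A → Bool) x xs → countᵇ p (x ∷ xs) ≡ 𝟙 (p x) + countᵇ p xs
  countᵇ-∷ p x xs with p x
  ... | true = refl
  ... | false = refl

  countᵇ-++ : ∀ (p : A → Bool) xs ys → countᵇ p (xs ++ ys) ≡ countᵇ p xs + countᵇ p ys
  countᵇ-++ p [] ys = refl
  countᵇ-++ p (x ∷ xs) ys = begin
    countᵇ p (x ∷ xs ++ ys)                  ≡⟨ countᵇ-∷ p x (xs ++ ys) ⟩
    𝟙 (p x) + countᵇ p (xs ++ ys)            ≡⟨ cong (𝟙 (p x) +_) (countᵇ-++ p xs ys) ⟩
    𝟙 (p x) + (countᵇ p xs + countᵇ p ys)    ≡⟨ +-assoc (𝟙 (p x)) _ _ ⟨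
    𝟙 (p x) + countᵇ p xs + countᵇ p ys      ≡⟨ cong (_+ countᵇ p ys) (countᵇ-∷ p x xs) ⟨
    countᵇ p (x ∷ xs) + countᵇ p ys          ∎
    where open ≡.≡-Reasoning

  countᵇ-map : ∀ (p : B → Bool) (f : A → B) xs → countᵇ p (map f xs) ≡ countᵇ (p ∘ f) xs
  countᵇ-map p f [] = refl
  countᵇ-map p f (x ∷ xs) with p (f x)
  ... | true = cong suc (countᵇ-map p f xs)
  ... | false = countᵇ-map p f xs

  countᵇ-cong : ∀ {p q : A → Bool} xs → (∀ {x} → x ∈ xs → p x ≡ q x) → countᵇ p xs ≡ countᵇ q xs
  countᵇ-cong [] _ = refl
  countᵇ-cong {p = p} {q} (x ∷ xs) p≗q = begin
    countᵇ p (x ∷ xs)          ≡⟨ countᵇ-∷ p x xs ⟩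
    𝟙 (p x) + countᵇ p xs      ≡⟨ cong₂ _+_ (cong 𝟙 (p≗q (here refl))) (countᵇ-cong xs (p≗q ∘ there)) ⟩
    𝟙 (q x) + countᵇ q xs      ≡⟨ countᵇ-∷ q x xs ⟨
    countᵇ q (x ∷ xs)          ∎
    where open ≡.≡-Reasoning

  countᵇ-≤-length : ∀ (p : A → Bool) xs → countᵇ p xs ≤ length xs
  countᵇ-≤-length p [] = z≤n
  countᵇ-≤-length p (x ∷ xs) with p x
  ... | true = s≤s (countᵇ-≤-length p xs)
  ... | false = m≤n⇒m≤1+n (countᵇ-≤-length p xs)

  countᵇ-all : ∀ {p : A → Bool} xs → All (λ x → p x ≡ true) xs → countᵇ p xs ≡ length xs
  countᵇ-all [] [] = refl
  countᵇ-all (x ∷ xs) (px ∷ pxs) rewrite px = cong suc (countᵇ-all xs pxs)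

  countᵇ-none : ∀ {p : A → Bool} xs → (∀ {x} → x ∈ xs → p x ≡ false) → countᵇ p xs ≡ 0
  countᵇ-none [] _ = refl
  countᵇ-none (x ∷ xs) ¬p rewrite ¬p (here refl) = countᵇ-none xs (¬p ∘ there)

  countᵇ-mono : ∀ {p q : A → Bool} xs → (∀ {x} → p x ≡ true → q x ≡ true) → countᵇ p xs ≤ countᵇ q xs
  countᵇ-mono [] _ = z≤n
  countᵇ-mono {p = p} {q} (x ∷ xs) p⇒q with p x in px | q x in qx
  ... | true  | true  = s≤s (countᵇ-mono xs p⇒q)
  ... | true  | false with () ← ≡.trans (sym (p⇒q px)) qx
  ... | false | true  = m≤n⇒m≤1+n (countᵇ-mono xs p⇒q)
  ... | false | false = countᵇ-mono xs p⇒q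

  countᵇ-mono-< : ∀ {p q : A → Bool} {z} xs → (∀ {x} → p x ≡ true → q x ≡ true) →
    z ∈ xs → p z ≡ false → q z ≡ true → countᵇ p xs < countᵇ q xs
  countᵇ-mono-< {p = p} {q} (x ∷ xs) p⇒q (here refl) pz qz rewrite pz | qz = s≤s (countᵇ-mono xs p⇒q)
  countᵇ-mono-< {p = p} {q} (x ∷ xs) p⇒q (there z∈) pz qz with p x in px | q x in qx
  ... | true  | true  = s≤s (countᵇ-mono-< xs p⇒q z∈ pz qz)
  ... | true  | false with () ← ≡.trans (sym (p⇒q px)) qx
  ... | false | true  = m≤n⇒m≤1+n (countᵇ-mono-< xs p⇒q z∈ pz qz)
  ... | false | false = countᵇ-mono-< xs p⇒q z∈ pz qz

  countᵇ-unique : ∀ {p : A → Bool} {y} xs → Unique xs → y ∈ xs → p y ≡ true →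
    (∀ {x} → x ∈ xs → p x ≡ true → x ≡ y) → countᵇ p xs ≡ 1
  countᵇ-unique (x ∷ xs) (x∉xs ∷ _) (here refl) py only rewrite py =
    cong suc (countᵇ-none xs (λ {z} z∈ → ¬T⇒≡false (λ pz → All.lookup x∉xs z∈ (sym (only (there z∈) (T⇒≡true pz))))))
  countᵇ-unique {p = p} (x ∷ xs) (x∉xs ∷ u) (there y∈) py only with p x in px
  ... | true  = ⊥-elim (All.lookup x∉xs (subst (_∈ xs) (sym (only (here refl) px)) y∈) refl)
  ... | false = countᵇ-unique xs u y∈ py (only ∘ there)

  countᵇ-↭ : ∀ (p : A → Bool) {xs ys} → xs ↭ ys → countᵇ p xs ≡ countᵇ p ys
  countᵇ-↭ p refl = refl
  countᵇ-↭ p (prep x xs↭ys) with p x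
  ... | true  = cong suc (countᵇ-↭ p xs↭ys)
  ... | false = countᵇ-↭ p xs↭ys
  countᵇ-↭ p (swap x y xs↭ys) with p x | p y
  ... | true  | true  = cong (suc ∘ suc) (countᵇ-↭ p xs↭ys)
  ... | true  | false = cong suc (countᵇ-↭ p xs↭ys)
  ... | false | true  = cong suc (countᵇ-↭ p xs↭ys)
  ... | false | false = countᵇ-↭ p xs↭ys
  countᵇ-↭ p (trans xs↭ys ys↭zs) = ≡.trans (countᵇ-↭ p xs↭ys) (countᵇ-↭ p ys↭zs)

  sum-map-const : ∀ c (xs : List A) → sum (map (λ _ → c) xs) ≡ length xs * c
  sum-map-const c [] = refl
  sum-map-const c (x ∷ xs) = cong (c +_) (sum-map-const c xs)

  countᵇ-sum : ∀ {p : A → Bool} (ps : B → A → Bool) (rs : List B) xs →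
    (∀ {x} → x ∈ xs → 𝟙 (p x) ≡ sum (map (λ r → 𝟙 (ps r x)) rs)) →
    countᵇ p xs ≡ sum (map (λ r → countᵇ (ps r) xs) rs)
  countᵇ-sum ps rs [] _ = sym (≡.trans (sum-map-const 0 rs) (*-zeroʳ (length rs)))
  countᵇ-sum {p = p} ps rs (x ∷ xs) split = begin
    countᵇ p (x ∷ xs)                                                            ≡⟨ countᵇ-∷ p x xs ⟩
    𝟙 (p x) + countᵇ p xs                                                        ≡⟨ cong₂ _+_ (split (here refl)) (countᵇ-sum ps rs xs (split ∘ there)) ⟩
    sum (map (λ r → 𝟙 (ps r x)) rs) + sum (map (λ r → countᵇ (ps r) xs) rs)     ≡⟨ ℕΣ.Σ-map-+ _ _ rs ⟨
    sum (map (λ r → 𝟙 (ps r x) + countᵇ (ps r) xs) rs)                          ≡⟨ ℕΣ.Σ-map-cong rs (λ {r} _ → countᵇ-∷ (ps r) x xs) ⟨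
    sum (map (λ r → countᵇ (ps r) (x ∷ xs)) rs)                                  ∎
    where open ≡.≡-Reasoning

  sum-map-𝟙 : ∀ (p : A → Bool) xs → sum (map (𝟙 ∘ p) xs) ≡ countᵇ p xs
  sum-map-𝟙 p [] = refl
  sum-map-𝟙 p (x ∷ xs) = ≡.trans (cong (𝟙 (p x) +_) (sum-map-𝟙 p xs)) (sym (countᵇ-∷ p x xs))

  ∈-incr⁺ : ∀ {n x} → 1 ≤ x → x ≤ n → x ∈ incr n
  ∈-incr⁺ {x = suc x} _ x<n = ∈-map⁺ suc (∈-upTo⁺ x<n)

  ∈-incr⁻ : ∀ {n x} → x ∈ incr n → 1 ≤ x × x ≤ n
  ∈-incr⁻ x∈ with ∈-map⁻ suc x∈
  ... | _ , y∈ , refl = s≤s z≤n , ∈-upTo⁻ y∈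

  length-incr : ∀ n → length (incr n) ≡ n
  length-incr n = ≡.trans (length-map suc (upTo n)) (length-upTo n)

  incr-unique : ∀ n → Unique (incr n)
  incr-unique n = Unique.map⁺ suc-injective (Unique.upTo⁺ n)

  incr-suc : ∀ n → incr (suc n) ≡ incr n ∷ʳ suc n
  incr-suc n = ≡.trans (cong (map suc) (sym (upTo-∷ʳ n))) (map-++ suc (upTo n) [ n ])

  length-∷ʳ : ∀ (xs : List A) x → length (xs ∷ʳ x) ≡ suc (length xs)
  length-∷ʳ [] x = refl
  length-∷ʳ (y ∷ xs) x = cong suc (length-∷ʳ xs x)

  record IsPerm (N : ℕ) (π : List ℕ) : Set where
    field
      length≡ : length π ≡ N
      bounded : All (_∈ incr N) π
      unique  : Unique π

  incr-isPerm : ∀ n → IsPerm n (incr n)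
  incr-isPerm n = record { length≡ = length-incr n ; bounded = All.tabulate (λ x∈ → x∈) ; unique = incr-unique n }

  concatMap≡cartesianProductWith : ∀ (f : A → B → C) xs ys →
    concatMap (λ x → map (f x) ys) xs ≡ cartesianProductWith f xs ys
  concatMap≡cartesianProductWith f [] ys = refl
  concatMap≡cartesianProductWith f (x ∷ xs) ys = cong (map (f x) ys ++_) (concatMap≡cartesianProductWith f xs ys)

  words-suc : ∀ N n → words N (suc n) ≡ cartesianProductWith _∷ʳ_ (words N n) (incr N)
  words-suc N n = concatMap≡cartesianProductWith _∷ʳ_ (words N n) (incr N)

  words-unique : ∀ N n → Unique (words N n)
  words-unique N zero = [] ∷ []
  words-unique N (suc n) rewrite words-suc N n =
    Unique.cartesianProductWith⁺ _∷ʳ_ (λ {w} {x} → ∷ʳ-injective w x) (words-unique N n) (incr-unique N)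

  ∈-words⁻ : ∀ N n {π} → π ∈ words N n → length π ≡ n × All (_∈ incr N) π
  ∈-words⁻ N zero (here refl) = refl , []
  ∈-words⁻ N (suc n) π∈ rewrite words-suc N n with ∈-cartesianProductWith⁻ _∷ʳ_ (words N n) (incr N) π∈
  ... | w , a , w∈ , a∈ , refl with ∈-words⁻ N n w∈
  ...   | refl , w⊆ = length-∷ʳ w a , All.∷ʳ⁺ w⊆ a∈

  ∈-words⁺ : ∀ N n {π} → length π ≡ n → All (_∈ incr N) π → π ∈ words N n
  ∈-words⁺ N zero {[]} refl [] = here refl
  ∈-words⁺ N (suc n) {π} len π⊆ with initLast π
  ∈-words⁺ N (suc n) {.[]} () π⊆ | []
  ∈-words⁺ N (suc n) {.(w ∷ʳ a)} len π⊆ | w ∷ʳ′ a rewrite words-suc N n =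
    ∈-cartesianProductWith⁺ _∷ʳ_ (∈-words⁺ N n (suc-injective (≡.trans (sym (length-∷ʳ w a)) len)) w⊆) a∈
    where
    w⊆ = proj₁ (All.∷ʳ⁻ π⊆)
    a∈ = proj₂ (All.∷ʳ⁻ π⊆)

  ∈-filterB⁻ : ∀ (p : A → Bool) {x} xs → x ∈ filterB p xs → x ∈ xs × p x ≡ true
  ∈-filterB⁻ p (y ∷ xs) x∈ with p y in py
  ∈-filterB⁻ p (y ∷ xs) (here refl) | true = here refl , py
  ∈-filterB⁻ p (y ∷ xs) (there x∈) | true = map₁ there (∈-filterB⁻ p xs x∈)
  ∈-filterB⁻ p (y ∷ xs) x∈ | false = map₁ there (∈-filterB⁻ p xs x∈)

  ∈-filterB⁺ : ∀ (p : A → Bool) {x xs} → x ∈ xs → p x ≡ true → x ∈ filterB p xs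
  ∈-filterB⁺ p {xs = y ∷ xs} (here refl) px rewrite px = here refl
  ∈-filterB⁺ p {xs = y ∷ xs} (there x∈) px with p y
  ... | true  = there (∈-filterB⁺ p x∈ px)
  ... | false = ∈-filterB⁺ p x∈ px

  filterB-unique : ∀ (p : A → Bool) {xs} → Unique xs → Unique (filterB p xs)
  filterB-unique p [] = []
  filterB-unique p {y ∷ xs} (y∉ ∷ u) with p y
  ... | true  = All.tabulate (All.lookup y∉ ∘ proj₁ ∘ ∈-filterB⁻ p xs) ∷ filterB-unique p u
  ... | false = filterB-unique p u

  countᵇ≡0⇒ : ∀ {p : A → Bool} {x} xs → countᵇ p xs ≡ 0 → x ∈ xs → p x ≡ false
  countᵇ≡0⇒ {p = p} (y ∷ xs) c x∈ with p y in py
  countᵇ≡0⇒ (y ∷ xs) c (here refl) | false = py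
  countᵇ≡0⇒ (y ∷ xs) c (there x∈) | false = countᵇ≡0⇒ xs c x∈

  distinct⇒Unique : ∀ xs → distinct xs ≡ true → Unique xs
  distinct⇒Unique [] _ = []
  distinct⇒Unique (x ∷ xs) d with countᵇ (λ y → y ≡ᵇ x) xs in c
  ... | zero = All.tabulate (λ y∈ → ≡ᵇ-false⇒≢ (countᵇ≡0⇒ xs c y∈) ∘ sym) ∷ distinct⇒Unique xs d

  Unique⇒distinct : ∀ {xs} → Unique xs → distinct xs ≡ true
  Unique⇒distinct [] = refl
  Unique⇒distinct {x ∷ xs} (x∉ ∷ u)
    rewrite countᵇ-none {p = λ y → y ≡ᵇ x} xs (λ y∈ → ≢⇒≡ᵇ-false (All.lookup x∉ y∈ ∘ sym)) = Unique⇒distinct u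

  ∈-Sym⁻ : ∀ {N π} → π ∈ Sym N → IsPerm N π
  ∈-Sym⁻ {N} {π} π∈ with ∈-filterB⁻ distinct (words N N) π∈
  ... | π∈words , d with ∈-words⁻ N N π∈words
  ...   | len , π⊆ = record { length≡ = len ; bounded = π⊆ ; unique = distinct⇒Unique π d }

  ∈-Sym⁺ : ∀ {N π} → IsPerm N π → π ∈ Sym N
  ∈-Sym⁺ {N} p = ∈-filterB⁺ distinct (∈-words⁺ N N length≡ bounded) (Unique⇒distinct unique)
    where open IsPerm p

  Sym-unique : ∀ N → Unique (Sym N)
  Sym-unique N = filterB-unique distinct (words-unique N N)

  ∈-++-∷⁻ : ∀ {z y : A} xs {ys} → z ∈ xs ++ y ∷ ys → z ≢ y → z ∈ xs ++ ys
  ∈-++-∷⁻ xs z∈ z≢y with ∈-++⁻ xs z∈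
  ... | inj₁ z∈xs = ∈-++⁺ˡ z∈xs
  ... | inj₂ (here z≡y) = ⊥-elim (z≢y z≡y)
  ... | inj₂ (there z∈ys) = ∈-++⁺ʳ xs z∈ys

  Unique-⊆⇒length≤ : ∀ {xs ys : List A} → Unique xs → xs ⊆ ys → length xs ≤ length ys
  Unique-⊆⇒length≤ {xs = []} [] _ = z≤n
  Unique-⊆⇒length≤ {xs = x ∷ xs} (x∉ ∷ u) xs⊆ys with ∈-∃++ (xs⊆ys (here refl))
  ... | as , bs , refl = ≤-trans (s≤s (Unique-⊆⇒length≤ u xs⊆as++bs)) (≤-reflexive (sym (length-++-sucʳ as x bs)))
    where
    xs⊆as++bs : xs ⊆ as ++ bs
    xs⊆as++bs z∈ = ∈-++-∷⁻ as (xs⊆ys (there z∈)) (All.lookup x∉ z∈ ∘ sym)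

  IsPerm⇒incr⊆ : ∀ {N π} → IsPerm N π → incr N ⊆ π
  IsPerm⇒incr⊆ {N} {π} p {y} y∈incr with y ∈? π
  ... | yes y∈π = y∈π
  ... | no y∉π with ∈-∃++ y∈incr
  ...   | as , bs , incr≡ = ⊥-elim (<-irrefl refl (begin-strict
    N                    ≡⟨ length≡ ⟨
    length π             ≤⟨ Unique-⊆⇒length≤ unique π⊆as++bs ⟩
    length (as ++ bs)    <⟨ n<1+n _ ⟩
    suc (length (as ++ bs)) ≡⟨ length-++-sucʳ as y bs ⟨
    length (as ++ y ∷ bs)   ≡⟨ cong length incr≡ ⟨
    length (incr N)      ≡⟨ length-incr N ⟩
    N                    ∎))
    where
    open IsPerm p
    open ≤-Reasoning
    π⊆as++bs : π ⊆ as ++ bs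
    π⊆as++bs {z} z∈ = ∈-++-∷⁻ as (subst (z ∈_) incr≡ (All.lookup bounded z∈)) (λ { refl → y∉π z∈ })

  IsPerm⇒↭incr : ∀ {N π} → IsPerm N π → π ↭ incr N
  IsPerm⇒↭incr {N} p = ∼bag⇒↭ (unique∧set⇒bag unique (incr-unique N) (mk⇔ (All.lookup bounded) (IsPerm⇒incr⊆ p)))
    where open IsPerm p

  rank : List ℕ → ℕ → ℕ
  rank t x = suc (countᵇ (_<ᵇ x) t)

  countᵇ-<ᵇ-upTo : ∀ n x → countᵇ (_<ᵇ x) (upTo n) ≡ n ⊓ x
  countᵇ-<ᵇ-upTo zero x = refl
  countᵇ-<ᵇ-upTo (suc n) x = begin
    countᵇ (_<ᵇ x) (upTo (suc n))               ≡⟨ cong (countᵇ (_<ᵇ x)) (upTo-∷ʳ n) ⟨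
    countᵇ (_<ᵇ x) (upTo n ∷ʳ n)                ≡⟨ countᵇ-++ (_<ᵇ x) (upTo n) [ n ] ⟩
    countᵇ (_<ᵇ x) (upTo n) + countᵇ (_<ᵇ x) [ n ] ≡⟨ cong (_+ countᵇ (_<ᵇ x) [ n ]) (countᵇ-<ᵇ-upTo n x) ⟩
    n ⊓ x + countᵇ (_<ᵇ x) [ n ]                ≡⟨ step (n <? x) ⟩
    suc n ⊓ x                                    ∎
    where
    open ≡.≡-Reasoning
    step : Dec (n < x) → n ⊓ x + countᵇ (_<ᵇ x) [ n ] ≡ suc n ⊓ x
    step (yes n<x) rewrite <⇒<ᵇ-true n<x | m≤n⇒m⊓n≡m (<⇒≤ n<x) | m≤n⇒m⊓n≡m n<x = +-comm n 1
    step (no n≮x) rewrite ≥⇒<ᵇ-false (≮⇒≥ n≮x) | m≥n⇒m⊓n≡n (≮⇒≥ n≮x) | m≥n⇒m⊓n≡n (m≤n⇒m≤1+n (≮⇒≥ n≮x))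
      = +-identityʳ x

  rank-perm : ∀ {N π x} → IsPerm N π → x ∈ π → rank π x ≡ x
  rank-perm {N} {π} {x} p x∈ with ∈-incr⁻ (All.lookup (IsPerm.bounded p) x∈)
  rank-perm {N} {π} {suc x} p x∈ | _ , x<N = cong suc (begin
    countᵇ (_<ᵇ suc x) π           ≡⟨ countᵇ-↭ (_<ᵇ suc x) (IsPerm⇒↭incr p) ⟩
    countᵇ (_<ᵇ suc x) (incr N)    ≡⟨ countᵇ-map (_<ᵇ suc x) suc (upTo N) ⟩
    countᵇ (_<ᵇ x) (upTo N)        ≡⟨ countᵇ-<ᵇ-upTo N x ⟩
    N ⊓ x                          ≡⟨ m≥n⇒m⊓n≡n (<⇒≤ x<N) ⟩
    x                              ∎)
    where open ≡.≡-Reasoning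

  restrict-perm : ∀ {N π} → IsPerm N π → restrict N π ≡ π
  restrict-perm {N} {π} p rewrite take-all N π (≤-reflexive (IsPerm.length≡ p)) =
    map-id-local (All.tabulate (rank-perm p))

  shift : ℕ → ℕ → ℕ
  shift r x = if r ≤ᵇ x then suc x else x

  shift-≥ : ∀ {r x} → r ≤ x → shift r x ≡ suc x
  shift-≥ r≤x rewrite ≤⇒≤ᵇ-true r≤x = refl

  shift-< : ∀ {r x} → x < r → shift r x ≡ x
  shift-< x<r rewrite >⇒≤ᵇ-false x<r = refl

  shift-injective : ∀ r {x y} → shift r x ≡ shift r y → x ≡ y
  shift-injective r {x} {y} eq with r ≤? x | r ≤? y
  ... | yes r≤x | yes r≤y = suc-injective (≡.trans (sym (shift-≥ r≤x)) (≡.trans eq (shift-≥ r≤y)))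
  ... | no r≰x  | no r≰y  = ≡.trans (sym (shift-< (≰⇒> r≰x))) (≡.trans eq (shift-< (≰⇒> r≰y)))
  ... | yes r≤x | no r≰y  = ⊥-elim (<-irrefl (≡.trans (sym (shift-< (≰⇒> r≰y))) (≡.trans (sym eq) (shift-≥ r≤x)))
                                               (≤-trans (≰⇒> r≰y) (m≤n⇒m≤1+n r≤x)))
  ... | no r≰x  | yes r≤y = ⊥-elim (<-irrefl (≡.trans (sym (shift-< (≰⇒> r≰x))) (≡.trans eq (shift-≥ r≤y)))
                                               (≤-trans (≰⇒> r≰x) (m≤n⇒m≤1+n r≤y)))

  shift-≢ : ∀ r x → shift r x ≢ r
  shift-≢ r x with r ≤? x
  ... | yes r≤x = λ eq → <-irrefl (sym (≡.trans (sym (shift-≥ r≤x)) eq)) (s≤s r≤x)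
  ... | no r≰x  = λ eq → <-irrefl (≡.trans (sym (shift-< (≰⇒> r≰x))) eq) (≰⇒> r≰x)

  length-extend : ∀ σ r → length (extend σ r) ≡ suc (length σ)
  length-extend σ r = ≡.trans (length-∷ʳ (map (shift r) σ) r) (cong suc (length-map (shift r) σ))

  incr-extend : ∀ m → incr (suc m) ≡ extend (incr m) (suc m)
  incr-extend m = ≡.trans (incr-suc m)
    (cong (_∷ʳ suc m) (sym (map-id-local (All.tabulate (λ x∈ → shift-< (s≤s (proj₂ (∈-incr⁻ x∈))))))))

  extend-injective : ∀ {ρ σ r₀ r} → extend ρ r₀ ≡ extend σ r → ρ ≡ σ × r₀ ≡ r
  extend-injective {ρ} {σ} {r₀} {r} eq with ∷ʳ-injective (map (shift r₀) ρ) (map (shift r) σ) eq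
  ... | eq′ , refl = map-injective (shift-injective r₀) eq′ , refl

  IsPerm-extend : ∀ {k σ r} → IsPerm k σ → r ∈ incr (suc k) → IsPerm (suc k) (extend σ r)
  IsPerm-extend {k} {σ} {r} p r∈ = record
    { length≡ = ≡.trans (length-extend σ r) (cong suc length≡)
    ; bounded = All.∷ʳ⁺ (All.map⁺ (All.map shift∈ bounded)) r∈
    ; unique  = Unique.++⁺ (Unique.map⁺ (shift-injective r) unique) ([] ∷ []) r∉
    }
    where
    open IsPerm p
    shift∈ : ∀ {x} → x ∈ incr k → shift r x ∈ incr (suc k)
    shift∈ {x} x∈ with ∈-incr⁻ x∈ | r ≤? x
    ... | 1≤x , x≤k | yes r≤x = subst (_∈ incr (suc k)) (sym (shift-≥ r≤x)) (∈-incr⁺ (s≤s z≤n) (s≤s x≤k))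
    ... | 1≤x , x≤k | no r≰x  = subst (_∈ incr (suc k)) (sym (shift-< (≰⇒> r≰x))) (∈-incr⁺ 1≤x (m≤n⇒m≤1+n x≤k))
    r∉ : ∀ {v} → ¬ (v ∈ map (shift r) σ × v ∈ [ r ])
    r∉ (v∈ , here refl) with ∈-map⁻ (shift r) v∈
    ... | x , _ , eq = shift-≢ r x (sym eq)

  -- 0-based index p, i.e. position suc p in the 1-based convention of valueAtIs.
  data At {A : Set} : ℕ → A → List A → Set where
    here  : ∀ {x xs} → At zero x (x ∷ xs)
    there : ∀ {p x y xs} → At p x xs → At (suc p) x (y ∷ xs)

  At-index : ∀ p (xs : List A) → p < length xs → ∃[ x ] At p x xs
  At-index zero (x ∷ xs) _ = x , here
  At-index (suc p) (y ∷ xs) (s≤s p<n) with At-index p xs p<n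
  ... | x , at = x , there at

  At⇒∈ : ∀ {p} {x : A} {xs} → At p x xs → x ∈ xs
  At⇒∈ here = here refl
  At⇒∈ (there at) = there (At⇒∈ at)

  At-< : ∀ {p} {x : A} {xs} → At p x xs → p < length xs
  At-< here = s≤s z≤n
  At-< (there at) = s≤s (At-< at)

  At-functional : ∀ {p} {x y : A} {xs} → At p x xs → At p y xs → x ≡ y
  At-functional here here = refl
  At-functional (there at) (there at′) = At-functional at at′

  At-map : ∀ (f : A → B) {p x xs} → At p x xs → At p (f x) (map f xs)
  At-map f here = here
  At-map f (there at) = there (At-map f at)

  At-take : ∀ {p m} {x : A} {xs} → At p x xs → p < m → At p x (take m xs)
  At-take {m = suc m} here _ = here
  At-take {m = suc m} (there at) (s≤s p<m) = there (At-take at p<m)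

  At-++ : ∀ {p} {x : A} {xs} ys → At p x xs → At p x (xs ++ ys)
  At-++ ys here = here
  At-++ ys (there at) = there (At-++ ys at)

  At-∷ʳ : ∀ (xs : List A) x → At (length xs) x (xs ∷ʳ x)
  At-∷ʳ [] x = here
  At-∷ʳ (y ∷ xs) x = there (At-∷ʳ xs x)

  At-extend : ∀ r {p x σ} → At p x σ → At p (shift r x) (extend σ r)
  At-extend r at = At-++ [ r ] (At-map (shift r) at)

  At-extend-last : ∀ {k} σ r → length σ ≡ k → At k r (extend σ r)
  At-extend-last σ r len = subst (λ i → At i r (extend σ r)) (≡.trans (length-map (shift r) σ) len) (At-∷ʳ (map (shift r) σ) r)

  take-suc-At : ∀ {p} {x : A} {xs} → At p x xs → take (suc p) xs ≡ take p xs ∷ʳ x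
  take-suc-At here = refl
  take-suc-At {xs = y ∷ _} (there at) = cong (y ∷_) (take-suc-At at)

  At-∉-take : ∀ {p} {x : A} {xs} → Unique xs → At p x xs → x ∉ take p xs
  At-∉-take u here ()
  At-∉-take (y∉ ∷ u) (there at) (here refl) = All.lookup y∉ (At⇒∈ at) refl
  At-∉-take (y∉ ∷ u) (there at) (there x∈) = At-∉-take u at x∈

  At⇒drop : ∀ {p} {x : A} {xs} → At p x xs → ∃[ rest ] drop p xs ≡ x ∷ rest
  At⇒drop {xs = x ∷ rest} here = rest , refl
  At⇒drop (there at) = At⇒drop at

  drop⇒At : ∀ p {x : A} {rest} xs → drop p xs ≡ x ∷ rest → At p x xs
  drop⇒At zero (x ∷ xs) refl = here
  drop⇒At (suc p) (y ∷ xs) eq = there (drop⇒At p xs eq)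

  valueAtIs-At : ∀ {p x v π} → At p x π → valueAtIs (suc p) v π ≡ (x ≡ᵇ v)
  valueAtIs-At at rewrite proj₂ (At⇒drop at) = refl

  valueAtIs⇒At : ∀ p {v} π → valueAtIs (suc p) v π ≡ true → At p v π
  valueAtIs⇒At p {v} π eq with drop p π in drop≡
  ... | x ∷ rest = subst (λ y → At p y π) (≡ᵇ-true⇒≡ eq) (drop⇒At p π drop≡)

  rank-∷ʳ : ∀ t x z → rank (t ∷ʳ x) z ≡ rank t z + 𝟙 (x <ᵇ z)
  rank-∷ʳ t x z = cong suc (≡.trans (countᵇ-++ (_<ᵇ z) t [ x ])
    (cong (countᵇ (_<ᵇ z) t +_) (≡.trans (countᵇ-∷ (_<ᵇ z) x []) (+-identityʳ (𝟙 (x <ᵇ z))))))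

  restrict-∷ʳ : ∀ t x → x ∉ t → map (rank (t ∷ʳ x)) (t ∷ʳ x) ≡ extend (map (rank t) t) (rank t x)
  restrict-∷ʳ t x x∉t = begin
    map (rank (t ∷ʳ x)) (t ∷ʳ x)                     ≡⟨ map-++ (rank (t ∷ʳ x)) t [ x ] ⟩
    map (rank (t ∷ʳ x)) t ∷ʳ rank (t ∷ʳ x) x         ≡⟨ cong₂ _∷ʳ_ (map-cong-∈ t old) last ⟩
    map (shift (rank t x) ∘ rank t) t ∷ʳ rank t x    ≡⟨ cong (_∷ʳ rank t x) (map-∘ t) ⟩
    extend (map (rank t) t) (rank t x)               ∎
    where
    open ≡.≡-Reasoning
    map-cong-∈ : ∀ {f g : ℕ → ℕ} xs → (∀ {z} → z ∈ xs → f z ≡ g z) → map f xs ≡ map g xs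
    map-cong-∈ xs f≗g = map-cong-local (All.tabulate f≗g)
    last : rank (t ∷ʳ x) x ≡ rank t x
    last = begin
      rank (t ∷ʳ x) x          ≡⟨ rank-∷ʳ t x x ⟩
      rank t x + 𝟙 (x <ᵇ x)    ≡⟨ cong (λ b → rank t x + 𝟙 b) (≥⇒<ᵇ-false (≤-refl {x})) ⟩
      rank t x + 0             ≡⟨ +-identityʳ (rank t x) ⟩
      rank t x                 ∎
    below-mono : ∀ {a b} → a < b → ∀ {y} → (y <ᵇ a) ≡ true → (y <ᵇ b) ≡ true
    below-mono a<b y<a = <⇒<ᵇ-true (<-trans (<ᵇ-true⇒< y<a) a<b)
    old : ∀ {z} → z ∈ t → rank (t ∷ʳ x) z ≡ shift (rank t x) (rank t z)
    old {z} z∈t with <-cmp x z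
    ... | tri< x<z _ _ rewrite rank-∷ʳ t x z | <⇒<ᵇ-true x<z =
      ≡.trans (+-comm (rank t z) 1) (sym (shift-≥ (s≤s (countᵇ-mono t (below-mono x<z)))))
    ... | tri≈ _ refl _ = ⊥-elim (x∉t z∈t)
    ... | tri> _ _ z<x rewrite rank-∷ʳ t x z | ≥⇒<ᵇ-false (<⇒≤ z<x) =
      ≡.trans (+-identityʳ (rank t z))
        (sym (shift-< (s≤s (countᵇ-mono-< t (below-mono z<x) z∈t (≥⇒<ᵇ-false (≤-refl {z})) (<⇒<ᵇ-true z<x)))))

  restrict-suc : ∀ {k π x} → Unique π → At k x π → restrict (suc k) π ≡ extend (restrict k π) (rank (take k π) x)
  restrict-suc {k} {π} {x} u at = begin
    map (rank (take (suc k) π)) (take (suc k) π)   ≡⟨ cong (λ t → map (rank t) t) (take-suc-At at) ⟩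
    map (rank (take k π ∷ʳ x)) (take k π ∷ʳ x)     ≡⟨ restrict-∷ʳ (take k π) x (At-∉-take u at) ⟩
    extend (restrict k π) (rank (take k π) x)      ∎
    where open ≡.≡-Reasoning

  rank-take-≤ : ∀ k π x → rank (take k π) x ≤ suc k
  rank-take-≤ k π x = s≤s (≤-trans (countᵇ-≤-length (_<ᵇ x) (take k π)) (≤-trans (≤-reflexive (length-take k π)) (m⊓n≤m k _)))

  eqL⇒≡ : ∀ xs ys → eqL xs ys ≡ true → xs ≡ ys
  eqL⇒≡ [] [] _ = refl
  eqL⇒≡ (x ∷ xs) (y ∷ ys) eq with ∧-true⁻ {x ≡ᵇ y} eq
  ... | x≡ᵇy , eq′ = cong₂ _∷_ (≡ᵇ-true⇒≡ x≡ᵇy) (eqL⇒≡ xs ys eq′)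

  eqL-refl : ∀ xs → eqL xs xs ≡ true
  eqL-refl [] = refl
  eqL-refl (x ∷ xs) rewrite ≡ᵇ-refl x = eqL-refl xs

  prefixed⇒restrict : ∀ σ π → prefixed σ π ≡ true → restrict (length σ) π ≡ σ
  prefixed⇒restrict σ π eq = eqL⇒≡ _ σ (proj₂ (∧-true⁻ {length σ ≤ᵇ length π} eq))

  restrict⇒prefixed : ∀ σ π → length σ ≤ length π → restrict (length σ) π ≡ σ → prefixed σ π ≡ true
  restrict⇒prefixed σ π σ≤π eq rewrite ≤⇒≤ᵇ-true σ≤π = subst (λ τ → eqL τ σ ≡ true) (sym eq) (eqL-refl σ)

  prefixed-full : ∀ {N σ π} → IsPerm N π → length σ ≡ N → prefixed σ π ≡ true → π ≡ σ
  prefixed-full {N} {σ} {π} perm len pre =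
    ≡.trans (sym (restrict-perm perm)) (subst (λ n → restrict n π ≡ σ) len (prefixed⇒restrict σ π pre))

  prefixed-extend : ∀ σ {π x} → Unique π → At (length σ) x π → ∀ r →
    prefixed (extend σ r) π ≡ (rank (take (length σ) π) x ≡ᵇ r) ∧ prefixed σ π
  prefixed-extend σ {π} {x} u at r = ⇔→≡ {z = true} (mk⇔ to from)
    where
    k = length σ
    r₀ = rank (take k π) x
    restrict-extend : restrict (length (extend σ r)) π ≡ extend σ r → restrict (suc k) π ≡ extend σ r
    restrict-extend = subst (λ n → restrict n π ≡ extend σ r) (length-extend σ r)
    to : prefixed (extend σ r) π ≡ true → ((r₀ ≡ᵇ r) ∧ prefixed σ π) ≡ true
    to pre with extend-injective (≡.trans (sym (restrict-suc u at)) (restrict-extend (prefixed⇒restrict (extend σ r) π pre)))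
    ... | ρ≡σ , refl rewrite ≡ᵇ-refl r₀ = restrict⇒prefixed σ π (<⇒≤ (At-< at)) ρ≡σ
    from : ((r₀ ≡ᵇ r) ∧ prefixed σ π) ≡ true → prefixed (extend σ r) π ≡ true
    from eq with ∧-true⁻ {r₀ ≡ᵇ r} eq
    ... | r₀≡ᵇr , pre with ≡ᵇ-true⇒≡ {r₀} {r} r₀≡ᵇr
    ... | refl = restrict⇒prefixed (extend σ r) π (≤-trans (≤-reflexive (length-extend σ r)) (At-< at))
                   (≡.trans (cong (λ n → restrict n π) (length-extend σ r))
                     (≡.trans (restrict-suc u at) (cong (λ ρ → extend ρ r₀) (prefixed⇒restrict σ π pre))))

  sum-𝟙-≡ᵇ-∧ : ∀ {r₀ rs} → Unique rs → r₀ ∈ rs → ∀ b → sum (map (λ r → 𝟙 ((r₀ ≡ᵇ r) ∧ b)) rs) ≡ 𝟙 b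
  sum-𝟙-≡ᵇ-∧ {r₀} {rs} u r₀∈ true = begin
    sum (map (λ r → 𝟙 ((r₀ ≡ᵇ r) ∧ true)) rs)  ≡⟨ ℕΣ.Σ-map-cong rs (λ {r} _ → cong 𝟙 (∧-identityʳ (r₀ ≡ᵇ r))) ⟩
    sum (map (λ r → 𝟙 (r₀ ≡ᵇ r)) rs)           ≡⟨ sum-map-𝟙 (r₀ ≡ᵇ_) rs ⟩
    countᵇ (r₀ ≡ᵇ_) rs                         ≡⟨ countᵇ-unique rs u r₀∈ (≡ᵇ-refl r₀) (λ _ → sym ∘ ≡ᵇ-true⇒≡) ⟩
    1                                          ∎
    where open ≡.≡-Reasoning
  sum-𝟙-≡ᵇ-∧ {r₀} {rs} u r₀∈ false = begin
    sum (map (λ r → 𝟙 ((r₀ ≡ᵇ r) ∧ false)) rs)  ≡⟨ ℕΣ.Σ-map-cong rs (λ {r} _ → cong 𝟙 (∧-zeroʳ (r₀ ≡ᵇ r))) ⟩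
    sum (map (λ _ → 0) rs)                      ≡⟨ sum-map-const 0 rs ⟩
    length rs * 0                               ≡⟨ *-zeroʳ (length rs) ⟩
    0                                           ∎
    where open ≡.≡-Reasoning

  -- Every σ-prefixed π has exactly one of the |σ| + 1 extensions of σ as its next prefix.
  countᵇ-prefixed-split : ∀ {N} σ (q : List ℕ → Bool) → length σ < N →
    countᵇ (λ π → prefixed σ π ∧ q π) (Sym N) ≡
    sum (map (λ r → countᵇ (λ π → prefixed (extend σ r) π ∧ q π) (Sym N)) (incr (suc (length σ))))
  countᵇ-prefixed-split {N} σ q σ<N = countᵇ-sum (λ r π → prefixed (extend σ r) π ∧ q π) (incr (suc k)) (Sym N) split
    where
    k = length σ
    split : ∀ {π} → π ∈ Sym N → 𝟙 (prefixed σ π ∧ q π) ≡ sum (map (λ r → 𝟙 (prefixed (extend σ r) π ∧ q π)) (incr (suc k)))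
    split {π} π∈ with At-index k π (subst (k <_) (sym (IsPerm.length≡ (∈-Sym⁻ {N} π∈))) σ<N)
    ... | x , at = sym (begin
      sum (map (λ r → 𝟙 (prefixed (extend σ r) π ∧ q π)) (incr (suc k)))
        ≡⟨ ℕΣ.Σ-map-cong (incr (suc k)) (λ {r} _ → cong 𝟙 (reassoc r)) ⟩
      sum (map (λ r → 𝟙 ((r₀ ≡ᵇ r) ∧ (prefixed σ π ∧ q π))) (incr (suc k)))
        ≡⟨ sum-𝟙-≡ᵇ-∧ (incr-unique (suc k)) (∈-incr⁺ (s≤s z≤n) (rank-take-≤ k π x)) (prefixed σ π ∧ q π) ⟩
      𝟙 (prefixed σ π ∧ q π) ∎)
      where
      open ≡.≡-Reasoning
      u = IsPerm.unique (∈-Sym⁻ {N} π∈)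
      r₀ = rank (take k π) x
      reassoc : ∀ r → (prefixed (extend σ r) π ∧ q π) ≡ ((r₀ ≡ᵇ r) ∧ (prefixed σ π ∧ q π))
      reassoc r = ≡.trans (cong (_∧ q π) (prefixed-extend σ u at r)) (∧-assoc (r₀ ≡ᵇ r) (prefixed σ π) (q π))

  SD-split : ∀ {N} σ → length σ < N → SD N σ ≡ sum (map (λ r → SD N (extend σ r)) (incr (suc (length σ))))
  SD-split {N} σ σ<N = begin
    SD N σ                                                    ≡⟨ SD-∧-true σ ⟩
    countᵇ (λ π → prefixed σ π ∧ true) (Sym N)                ≡⟨ countᵇ-prefixed-split σ (λ _ → true) σ<N ⟩
    sum (map (λ r → countᵇ (λ π → prefixed (extend σ r) π ∧ true) (Sym N)) (incr (suc (length σ))))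
                                                              ≡⟨ ℕΣ.Σ-map-cong (incr (suc (length σ))) (λ {r} _ → sym (SD-∧-true (extend σ r))) ⟩
    sum (map (λ r → SD N (extend σ r)) (incr (suc (length σ)))) ∎
    where
    open ≡.≡-Reasoning
    SD-∧-true : ∀ τ → SD N τ ≡ countᵇ (λ π → prefixed τ π ∧ true) (Sym N)
    SD-∧-true τ = countᵇ-cong (Sym N) (λ {π} _ → sym (∧-identityʳ (prefixed τ π)))

  SD-full : ∀ {N σ} → IsPerm N σ → SD N σ ≡ 1
  SD-full {N} {σ} p = countᵇ-unique (Sym N) (Sym-unique N) (∈-Sym⁺ p) σ-prefixed
    (λ π∈ → prefixed-full (∈-Sym⁻ {N} π∈) (IsPerm.length≡ p))
    where
    σ-prefixed : prefixed σ σ ≡ true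
    σ-prefixed = restrict⇒prefixed σ σ ≤-refl (subst (λ n → restrict n σ ≡ σ) (sym (IsPerm.length≡ p)) (restrict-perm p))

  -- Downward induction from k = N, where σ itself is the only σ-prefixed permutation.
  SD-factorial : ∀ {N k σ} → IsPerm k σ → k ≤ N → SD N σ * k ! ≡ N !
  SD-factorial {N} {k} p k≤N = go (N ∸ k) p (m+[n∸m]≡n k≤N)
    where
    go : ∀ d {k σ} → IsPerm k σ → k + d ≡ N → SD N σ * k ! ≡ N !
    go zero {k} {σ} p k+0≡N with ≡.trans (sym (+-identityʳ k)) k+0≡N
    ... | refl = ≡.trans (cong (_* k !) (SD-full p)) (*-identityˡ (k !))
    go (suc d) {k} {σ} p k+d≡N with refl ← IsPerm.length≡ p = *-cancelˡ-≡ (SD N σ * k !) (N !) (suc k) (begin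
      suc k * (SD N σ * k !)                                  ≡⟨ x∙yz≈y∙xz (suc k) (SD N σ) (k !) ⟩
      SD N σ * suc k !                                        ≡⟨ cong (_* suc k !) (SD-split σ k<N) ⟩
      sum (map (λ r → SD N (extend σ r)) rs) * suc k !        ≡⟨ ℕΣ.Σ-map-*ʳ (suc k !) (λ r → SD N (extend σ r)) rs ⟨
      sum (map (λ r → SD N (extend σ r) * suc k !) rs)        ≡⟨ ℕΣ.Σ-map-cong rs (λ r∈ → go d (IsPerm-extend p r∈) (≡.trans (sym (+-suc k d)) k+d≡N)) ⟩
      sum (map (λ _ → N !) rs)                                ≡⟨ sum-map-const (N !) rs ⟩
      length rs * N !                                         ≡⟨ cong (_* N !) (length-incr (suc k)) ⟩
      suc k * N !                                             ∎)
      where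
      open ≡.≡-Reasoning
      rs = incr (suc k)
      k<N : k < N
      k<N = subst (k <_) k+d≡N (m<m+n k z<s)

  SD-positive : ∀ {N k σ} → IsPerm k σ → k ≤ N → 0 < SD N σ
  SD-positive {N} {k} {σ} p k≤N =
    >-nonZero⁻¹ (SD N σ) {{m*n≢0⇒m≢0 (SD N σ) {{subst NonZero (sym (SD-factorial p k≤N)) (N !≢0)}}}}

  SD-extend : ∀ {N k σ r} → IsPerm k σ → k < N → r ∈ incr (suc k) → SD N σ ≡ suc k * SD N (extend σ r)
  SD-extend {N} {k} {σ} {r} p k<N r∈ = *-cancelʳ-≡ (SD N σ) (suc k * SD N (extend σ r)) (k !) {{k !≢0}} (begin
    SD N σ * k !                          ≡⟨ SD-factorial p (<⇒≤ k<N) ⟩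
    N !                                   ≡⟨ SD-factorial (IsPerm-extend p r∈) k<N ⟨
    SD N (extend σ r) * (suc k * k !)     ≡⟨ *-assoc (SD N (extend σ r)) (suc k) (k !) ⟨
    SD N (extend σ r) * suc k * k !       ≡⟨ cong (_* k !) (*-comm (SD N (extend σ r)) (suc k)) ⟩
    suc k * SD N (extend σ r) * k !       ∎)
    where open ≡.≡-Reasoning

  rank-max : ∀ {N t} → Unique t → All (_≤ N) t → N ∈ t → rank t N ≡ length t
  rank-max {N} {t = N ∷ t} (N∉t ∷ _) (_ ∷ t≤N) (here refl) rewrite ≥⇒<ᵇ-false (≤-refl {N}) =
    cong suc (countᵇ-all t (All.zipWith (λ (y≤N , N≢y) → <⇒<ᵇ-true (≤∧≢⇒< y≤N (N≢y ∘ sym))) (t≤N , N∉t)))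
  rank-max {N} {t = y ∷ t} (y∉t ∷ u) (y≤N ∷ t≤N) (there N∈t) rewrite <⇒<ᵇ-true (≤∧≢⇒< y≤N (All.lookup y∉t N∈t)) =
    cong suc (rank-max u t≤N N∈t)

  restrict-max : ∀ {N π p m} → IsPerm N π → At p N π → p < m → m ≤ N → At p m (restrict m π)
  restrict-max {N} {π} {p} {m} perm at p<m m≤N = subst (λ v → At p v (restrict m π)) rank≡m (At-map (rank t) at-t)
    where
    open IsPerm perm
    t = take m π
    at-t = At-take at p<m
    rank≡m : rank t N ≡ m
    rank≡m = begin
      rank t N      ≡⟨ rank-max (Unique.take⁺ m unique) (All.take⁺ m (All.map (proj₂ ∘ ∈-incr⁻) bounded)) (At⇒∈ at-t) ⟩
      length t      ≡⟨ length-take m π ⟩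
      m ⊓ length π  ≡⟨ m≤n⇒m⊓n≡m (≤-trans m≤N (≤-reflexive (sym length≡))) ⟩
      m             ∎
      where open ≡.≡-Reasoning

  prefixed-max : ∀ {N σ π p} → π ∈ Sym N → length σ ≤ N → p < length σ →
    (prefixed σ π ∧ valueAtIs (suc p) N π) ≡ true → At p (length σ) σ
  prefixed-max {N} {σ} {π} {p} π∈ σ≤N p<σ eq with ∧-true⁻ {prefixed σ π} eq
  ... | pre , val = subst (At p (length σ)) (prefixed⇒restrict σ π pre)
                      (restrict-max (∈-Sym⁻ {N} π∈) (valueAtIs⇒At p π val) p<σ σ≤N)

  WinAt : ℕ → ℕ → List ℕ → ℕ
  WinAt N p σ = countᵇ (λ π → prefixed σ π ∧ valueAtIs p N π) (Sym N)

  WinAt-full : ∀ {N σ p} → IsPerm N σ → At p N σ → WinAt N (suc p) σ ≡ SD N σ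
  WinAt-full {N} {σ} {p} perm at = countᵇ-cong (Sym N) pointwise
    where
    pointwise : ∀ {π} → π ∈ Sym N → (prefixed σ π ∧ valueAtIs (suc p) N π) ≡ prefixed σ π
    pointwise {π} π∈ with prefixed σ π in pre
    ... | false = refl
    ... | true rewrite prefixed-full (∈-Sym⁻ {N} π∈) (IsPerm.length≡ perm) pre = ≡.trans (valueAtIs-At at) (≡ᵇ-refl N)

  WinAt-extend-top : ∀ {N k σ p} → IsPerm k σ → k < N → At p k σ → WinAt N (suc p) (extend σ (suc k)) ≡ 0
  WinAt-extend-top {N} {k} {σ} {p} perm k<N at = countᵇ-none (Sym N) (λ π∈ → ¬≡true⇒≡false (impossible π∈))
    where
    σ′ = extend σ (suc k)
    len : length σ′ ≡ suc k
    len = IsPerm.length≡ (IsPerm-extend perm (∈-incr⁺ (s≤s z≤n) ≤-refl))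
    at-k : At p k σ′
    at-k = subst (λ v → At p v σ′) (shift-< ≤-refl) (At-extend (suc k) at)
    impossible : ∀ {π} → π ∈ Sym N → ¬ ((prefixed σ′ π ∧ valueAtIs (suc p) N π) ≡ true)
    impossible π∈ eq = 1+n≢n (At-functional (subst (λ n → At p n σ′) len max) at-k)
      where
      max = prefixed-max π∈ (≤-trans (≤-reflexive len) k<N) (At-< at-k) eq

  Win-extend-low : ∀ {N k σ r} → IsPerm k σ → k < N → r ≤ k → Win N (extend σ r) ≡ 0
  Win-extend-low {N} {k} {σ} {r} perm k<N r≤k = countᵇ-none (Sym N) (λ π∈ → ¬≡true⇒≡false (impossible π∈))
    where
    σ′ = extend σ r
    len : length σ′ ≡ suc k
    len = ≡.trans (length-extend σ r) (cong suc (IsPerm.length≡ perm))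
    at-r : At k r σ′
    at-r = At-extend-last σ r (IsPerm.length≡ perm)
    impossible : ∀ {π} → π ∈ Sym N → ¬ ((prefixed σ′ π ∧ valueAtIs (length σ′) N π) ≡ true)
    impossible {π} π∈ eq = <-irrefl (At-functional at-r (subst (λ n → At k n σ′) len max)) (s≤s r≤k)
      where
      eq′ : (prefixed σ′ π ∧ valueAtIs (suc k) N π) ≡ true
      eq′ = subst (λ n → (prefixed σ′ π ∧ valueAtIs n N π) ≡ true) len eq
      max = prefixed-max π∈ (≤-trans (≤-reflexive len) k<N) (At-< at-r) eq′

  WinAt-max : ∀ {N k σ p} → IsPerm k σ → k ≤ N → At p k σ → WinAt N (suc p) σ * N ≡ k * SD N σ
  WinAt-max {N} {k} perm k≤N = go (N ∸ k) perm (m+[n∸m]≡n k≤N)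
    where
    go : ∀ d {k σ p} → IsPerm k σ → k + d ≡ N → At p k σ → WinAt N (suc p) σ * N ≡ k * SD N σ
    go zero {k} {σ} perm k+0≡N at with ≡.trans (sym (+-identityʳ k)) k+0≡N
    ... | refl = ≡.trans (cong (_* k) (WinAt-full perm at)) (*-comm (SD N σ) k)
    go (suc d) {k} {σ} {p} perm k+d≡N at with refl ← IsPerm.length≡ perm = begin
      W σ * N                                                 ≡⟨ cong (_* N) (countᵇ-prefixed-split σ (valueAtIs (suc p) N) k<N) ⟩
      sum (map Wext (incr (suc k))) * N                       ≡⟨ cong (λ rs → sum (map Wext rs) * N) (incr-suc k) ⟩
      sum (map Wext (incr k ∷ʳ suc k)) * N                    ≡⟨ cong (_* N) (ℕΣ.Σ-map-++ Wext (incr k) [ suc k ]) ⟩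
      (sum (map Wext (incr k)) + (Wext (suc k) + 0)) * N      ≡⟨ cong (λ w → (sum (map Wext (incr k)) + (w + 0)) * N) (WinAt-extend-top perm k<N at) ⟩
      (sum (map Wext (incr k)) + 0) * N                       ≡⟨ cong (_* N) (+-identityʳ (sum (map Wext (incr k)))) ⟩
      sum (map Wext (incr k)) * N                             ≡⟨ ℕΣ.Σ-map-*ʳ N Wext (incr k) ⟨
      sum (map (λ r → Wext r * N) (incr k))                   ≡⟨ ℕΣ.Σ-map-cong (incr k) low ⟩
      sum (map (λ _ → SD N σ) (incr k))                       ≡⟨ sum-map-const (SD N σ) (incr k) ⟩
      length (incr k) * SD N σ                                ≡⟨ cong (_* SD N σ) (length-incr k) ⟩
      k * SD N σ                                              ∎
      where
      open ≡.≡-Reasoning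
      W = WinAt N (suc p)
      Wext = λ r → W (extend σ r)
      k<N : k < N
      k<N = subst (k <_) k+d≡N (m<m+n k z<s)
      low : ∀ {r} → r ∈ incr k → Wext r * N ≡ SD N σ
      low {r} r∈ = begin
        Wext r * N                  ≡⟨ go d (IsPerm-extend perm r∈′) (≡.trans (sym (+-suc k d)) k+d≡N) at′ ⟩
        suc k * SD N (extend σ r)   ≡⟨ SD-extend perm k<N r∈′ ⟨
        SD N σ                      ∎
        where
        1≤r = proj₁ (∈-incr⁻ r∈)
        r≤k = proj₂ (∈-incr⁻ r∈)
        r∈′ = ∈-incr⁺ 1≤r (m≤n⇒m≤1+n r≤k)
        at′ = subst (λ v → At p v (extend σ r)) (shift-≥ r≤k) (At-extend r at)

  Win-extend-top : ∀ {N k σ} → IsPerm k σ → k < N → Win N (extend σ (suc k)) * N ≡ suc k * SD N (extend σ (suc k))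
  Win-extend-top {N} {k} {σ} perm k<N = begin
    Win N σ′ * N              ≡⟨ cong (λ n → WinAt N n σ′ * N) len ⟩
    WinAt N (suc k) σ′ * N    ≡⟨ WinAt-max (IsPerm-extend perm top∈) k<N at ⟩
    suc k * SD N σ′           ∎
    where
    open ≡.≡-Reasoning
    σ′ = extend σ (suc k)
    top∈ = ∈-incr⁺ (s≤s z≤n) ≤-refl
    len : length σ′ ≡ suc k
    len = IsPerm.length≡ (IsPerm-extend perm top∈)
    at : At k (suc k) σ′
    at = At-extend-last σ (suc k) (IsPerm.length≡ perm)

module Values where

  open Permutations
  open import Data.Bool using (true; false; if_then_else_)
  open import Data.Integer as ℤ using (+_)
  import Data.Integer.Properties as ℤ
  open import Data.List.Properties using (map-∘)
  open import Data.Nat as ℕ using (ℕ; zero; suc; z≤n; s≤s; _≡ᵇ_)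
  import Data.Nat.Properties as ℕ
  open import Data.Rational using (ℚ; 0ℚ; 1ℚ; _+_; _*_; _⊔_; _≤_; toℚᵘ; nonNegative)
  open import Data.Rational.Properties
  import Data.Rational.Unnormalised as ℚᵘ
  import Data.Rational.Unnormalised.Properties as ℚᵘ

  toℚᵘ-frac : ∀ a n → toℚᵘ (frac a (suc n)) ℚᵘ.≃ ℚᵘ.mkℚᵘ (+ a) n
  toℚᵘ-frac a n = toℚᵘ-fromℚᵘ (ℚᵘ.mkℚᵘ (+ a) n)

  frac-cross : ∀ a b c d → 0 ℕ.< b → 0 ℕ.< d → a ℕ.* d ≡ c ℕ.* b → frac a b ≡ frac c d
  frac-cross a (suc b) c (suc d) _ _ eq = fromℚᵘ-cong {ℚᵘ.mkℚᵘ (+ a) b} {ℚᵘ.mkℚᵘ (+ c) d} (ℚᵘ.*≡* (begin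
    + a ℤ.* + suc d     ≡⟨ ℤ.pos-* a (suc d) ⟨
    + (a ℕ.* suc d)     ≡⟨ cong +_ eq ⟩
    + (c ℕ.* suc b)     ≡⟨ ℤ.pos-* c (suc b) ⟩
    + c ℤ.* + suc b     ∎))
    where open ≡.≡-Reasoning

  frac-0 : ∀ n → frac 0 n ≡ 0ℚ
  frac-0 zero = refl
  frac-0 (suc n) = 0/n≡0 (suc n)

  frac-nonNeg : ∀ a n → 0ℚ ≤ frac a n
  frac-nonNeg a zero = ≤-refl
  frac-nonNeg a (suc n) = nonNegative⁻¹ (frac a (suc n)) {{normalize-nonNeg a (suc n)}}

  frac-+ : ∀ a b n → frac a n + frac b n ≡ frac (a ℕ.+ b) n
  frac-+ a b zero = +-identityˡ 0ℚ
  frac-+ a b (suc n) = toℚᵘ-injective (begin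
    toℚᵘ (frac a (suc n) + frac b (suc n))                  ≈⟨ toℚᵘ-homo-+ (frac a (suc n)) (frac b (suc n)) ⟩
    toℚᵘ (frac a (suc n)) ℚᵘ.+ toℚᵘ (frac b (suc n))        ≈⟨ ℚᵘ.+-cong (toℚᵘ-frac a n) (toℚᵘ-frac b n) ⟩
    ℚᵘ.mkℚᵘ (+ a) n ℚᵘ.+ ℚᵘ.mkℚᵘ (+ b) n                     ≈⟨ ℚᵘ.*≡* cross ⟩
    ℚᵘ.mkℚᵘ (+ (a ℕ.+ b)) n                                  ≈⟨ toℚᵘ-frac (a ℕ.+ b) n ⟨
    toℚᵘ (frac (a ℕ.+ b) (suc n))                            ∎)
    where
    open ℚᵘ.≃-Reasoning
    d = + suc n
    cross : (+ a ℤ.* d ℤ.+ + b ℤ.* d) ℤ.* d ≡ + (a ℕ.+ b) ℤ.* (d ℤ.* d)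
    cross = ≡.trans (cong (ℤ._* d) (sym (ℤ.*-distribʳ-+ d (+ a) (+ b))))
              (≡.trans (ℤ.*-assoc (+ a ℤ.+ + b) d d) (cong (ℤ._* (d ℤ.* d)) (sym (ℤ.pos-+ a b))))

  frac-+-1 : ∀ a n → frac a n + frac 1 n ≡ frac (suc a) n
  frac-+-1 a n = ≡.trans (frac-+ a 1 n) (cong (λ b → frac b n) (ℕ.+-comm a 1))

  frac-* : ∀ a b n d → frac a (suc n) * frac b (suc d) ≡ frac (a ℕ.* b) (suc n ℕ.* suc d)
  frac-* a b n d = toℚᵘ-injective (begin
    toℚᵘ (frac a (suc n) * frac b (suc d))              ≈⟨ toℚᵘ-homo-* (frac a (suc n)) (frac b (suc d)) ⟩
    toℚᵘ (frac a (suc n)) ℚᵘ.* toℚᵘ (frac b (suc d))    ≈⟨ ℚᵘ.*-cong (toℚᵘ-frac a n) (toℚᵘ-frac b d) ⟩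
    ℚᵘ.mkℚᵘ (+ a) n ℚᵘ.* ℚᵘ.mkℚᵘ (+ b) d                 ≈⟨ ℚᵘ.*≡* (cong (ℤ._* + (suc n ℕ.* suc d)) (sym (ℤ.pos-* a b))) ⟩
    ℚᵘ.mkℚᵘ (+ (a ℕ.* b)) (ℕ.pred (suc n ℕ.* suc d))     ≈⟨ toℚᵘ-frac (a ℕ.* b) _ ⟨
    toℚᵘ (frac (a ℕ.* b) (suc n ℕ.* suc d))              ∎)
    where open ℚᵘ.≃-Reasoning

  private
    variable
      A : Set

  module ℚΣ = ListSum (CommutativeRing.semiring +-*-commutativeRing)

  Σ-map-mono : ∀ {f g : A → ℚ} xs → (∀ {x} → x ∈ xs → f x ≤ g x) → sumℚ (map f xs) ≤ sumℚ (map g xs)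
  Σ-map-mono [] _ = ≤-refl
  Σ-map-mono (x ∷ xs) f≤g = +-mono-≤ (f≤g (here refl)) (Σ-map-mono xs (f≤g ∘ there))

  Σ-map-const : ∀ x (xs : List A) → sumℚ (map (λ _ → x) xs) ≡ frac (length xs) 1 * x
  Σ-map-const x [] = sym (*-zeroˡ x)
  Σ-map-const x (_ ∷ xs) = begin
    x + sumℚ (map (λ _ → x) xs)        ≡⟨ cong₂ _+_ (sym (*-identityˡ x)) (Σ-map-const x xs) ⟩
    1ℚ * x + frac (length xs) 1 * x    ≡⟨ *-distribʳ-+ x 1ℚ (frac (length xs) 1) ⟨
    (1ℚ + frac (length xs) 1) * x      ≡⟨ cong (_* x) (frac-+ 1 (length xs) 1) ⟩
    frac (suc (length xs)) 1 * x       ∎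
    where open ≡.≡-Reasoning

  frac-*-inverse : ∀ m → frac (suc m) 1 * frac 1 (suc m) ≡ 1ℚ
  frac-*-inverse m = ≡.trans (frac-* (suc m) 1 0 m) (frac-cross (suc m ℕ.* 1) (1 ℕ.* suc m) 1 1 ℕ.z<s ℕ.z<s cross)
    where
    cross : suc m ℕ.* 1 ℕ.* 1 ≡ 1 ℕ.* (1 ℕ.* suc m)
    cross = ≡.trans (ℕ.*-identityʳ _) (≡.trans (ℕ.*-identityʳ _) (sym (≡.trans (ℕ.*-identityˡ _) (ℕ.*-identityˡ _))))

  average-const : ∀ m x → sumℚ (map (λ _ → frac 1 (suc m) * x) (incr (suc m))) ≡ x
  average-const m x = begin
    sumℚ (map (λ _ → frac 1 (suc m) * x) (incr (suc m)))     ≡⟨ Σ-map-const _ (incr (suc m)) ⟩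
    frac (length (incr (suc m))) 1 * (frac 1 (suc m) * x)    ≡⟨ cong (λ n → frac n 1 * (frac 1 (suc m) * x)) (length-incr (suc m)) ⟩
    frac (suc m) 1 * (frac 1 (suc m) * x)                    ≡⟨ *-assoc (frac (suc m) 1) _ x ⟨
    (frac (suc m) 1 * frac 1 (suc m)) * x                    ≡⟨ cong (_* x) (frac-*-inverse m) ⟩
    1ℚ * x                                                   ≡⟨ *-identityˡ x ⟩
    x                                                        ∎
    where open ≡.≡-Reasoning

  -- Q₁ of a prefix of length m + 1 whose last entry has relative rank r.
  Q₁-rank : ℕ → ℕ → ℕ → ℚ
  Q₁-rank N m r = if r ≡ᵇ suc m then frac (suc m) N else 0ℚ

  Q₁-rank-top : ∀ N m → Q₁-rank N m (suc m) ≡ frac (suc m) N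
  Q₁-rank-top N m = cong (λ b → if b then frac (suc m) N else 0ℚ) (≡ᵇ-refl m)

  -- One step of the Bellman recursion: the next relative rank r is uniform on {1..m+1};
  -- A is the continuation value after accepting, B the value of rejecting.
  bellman : ℕ → ℕ → ℚ → ℚ → ℚ
  bellman N m A B = sumℚ (map (λ r → frac 1 (suc m) * ((Q₁-rank N m r + A) ⊔ B)) (incr (suc m)))

  continuation : ℕ → ℕ → ℕ → ℚ
  continuation N zero f = 0ℚ
  continuation N (suc j) zero = 0ℚ
  continuation N (suc j) (suc f) = bellman N (N ℕ.∸ suc f) (continuation N j f) (continuation N (suc j) f)

  Q₁-rank-nonNeg : ∀ N m r → 0ℚ ≤ Q₁-rank N m r
  Q₁-rank-nonNeg N m r with r ≡ᵇ suc m
  ... | true  = frac-nonNeg (suc m) N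
  ... | false = ≤-refl

  Q₁-rank-≤ : ∀ N m r → Q₁-rank N m r ≤ frac (suc m) N
  Q₁-rank-≤ N m r with r ≡ᵇ suc m
  ... | true  = ≤-refl
  ... | false = frac-nonNeg (suc m) N

  Σ-Q₁-rank : ∀ N m → sumℚ (map (Q₁-rank N m) (incr (suc m))) ≡ frac (suc m) N
  Σ-Q₁-rank N m = begin
    sumℚ (map (Q₁-rank N m) (incr (suc m)))                                        ≡⟨ cong (sumℚ ∘ map (Q₁-rank N m)) (incr-suc m) ⟩
    sumℚ (map (Q₁-rank N m) (incr m ∷ʳ suc m))                                     ≡⟨ ℚΣ.Σ-map-++ (Q₁-rank N m) (incr m) _ ⟩
    sumℚ (map (Q₁-rank N m) (incr m)) + (Q₁-rank N m (suc m) + 0ℚ)                ≡⟨ cong₂ _+_ below (+-identityʳ (Q₁-rank N m (suc m))) ⟩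
    0ℚ + Q₁-rank N m (suc m)                                                       ≡⟨ +-identityˡ (Q₁-rank N m (suc m)) ⟩
    Q₁-rank N m (suc m)                                                            ≡⟨ Q₁-rank-top N m ⟩
    frac (suc m) N                                                                 ∎
    where
    open ≡.≡-Reasoning
    below : sumℚ (map (Q₁-rank N m) (incr m)) ≡ 0ℚ
    below = begin
      sumℚ (map (Q₁-rank N m) (incr m))     ≡⟨ ℚΣ.Σ-map-cong (incr m) zero-below ⟩
      sumℚ (map (λ _ → 0ℚ) (incr m))        ≡⟨ Σ-map-const 0ℚ (incr m) ⟩
      frac (length (incr m)) 1 * 0ℚ         ≡⟨ *-zeroʳ (frac (length (incr m)) 1) ⟩
      0ℚ                                    ∎
      where
      zero-below : ∀ {r} → r ∈ incr m → Q₁-rank N m r ≡ 0ℚ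
      zero-below {r} r∈ rewrite ≢⇒≡ᵇ-false (ℕ.<⇒≢ (s≤s (proj₂ (∈-incr⁻ r∈)))) = refl

  weight-mono : ∀ m {x y} → x ≤ y → frac 1 (suc m) * x ≤ frac 1 (suc m) * y
  weight-mono m = *-monoˡ-≤-nonNeg (frac 1 (suc m)) {{nonNegative (frac-nonNeg 1 (suc m))}}

  bellman-nonNeg : ∀ N m A {B} → 0ℚ ≤ B → 0ℚ ≤ bellman N m A B
  bellman-nonNeg N m A {B} 0≤B = begin
    0ℚ                                              ≡⟨ average-const m 0ℚ ⟨
    sumℚ (map (λ _ → frac 1 (suc m) * 0ℚ) (incr (suc m)))
      ≤⟨ Σ-map-mono (incr (suc m)) (λ {r} _ → weight-mono m (≤-trans 0≤B (p≤q⊔p (Q₁-rank N m r + A) B))) ⟩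
    bellman N m A B                                 ∎
    where open ≤-Reasoning

  bellman-mono : ∀ N m {A A′ B B′} → A ≤ A′ → B ≤ B′ → bellman N m A B ≤ bellman N m A′ B′
  bellman-mono N m A≤A′ B≤B′ = Σ-map-mono (incr (suc m))
    (λ {r} _ → weight-mono m (⊔-mono-≤ (+-monoʳ-≤ (Q₁-rank N m r) A≤A′) B≤B′))

  -- As A ≤ B, the term for rank r is at most Q₁-rank N m r + B, and the Q₁-rank average to 1/N.
  bellman-≤ : ∀ N m {A B} → suc m ℕ.≤ N → A ≤ B → bellman N m A B ≤ frac 1 N + B
  bellman-≤ (suc N) m {A} {B} _ A≤B = begin
    bellman (suc N) m A B
      ≤⟨ Σ-map-mono (incr (suc m)) (λ {r} _ → weight-mono m (⊔-lub (+-monoʳ-≤ (q r) A≤B) (B≤q+B r))) ⟩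
    sumℚ (map (λ r → w * (q r + B)) (incr (suc m)))
      ≡⟨ ℚΣ.Σ-map-cong (incr (suc m)) (λ {r} _ → *-distribˡ-+ w (q r) B) ⟩
    sumℚ (map (λ r → w * q r + w * B) (incr (suc m)))
      ≡⟨ ℚΣ.Σ-map-+ (λ r → w * q r) (λ _ → w * B) (incr (suc m)) ⟩
    sumℚ (map (λ r → w * q r) (incr (suc m))) + sumℚ (map (λ _ → w * B) (incr (suc m)))
      ≡⟨ cong₂ _+_ (≡.trans (ℚΣ.Σ-map-*ˡ w q (incr (suc m))) (cong (w *_) (Σ-Q₁-rank (suc N) m))) (average-const m B) ⟩
    w * frac (suc m) (suc N) + B
      ≡⟨ cong (_+ B) (≡.trans (frac-* 1 (suc m) m N) (frac-cross (1 ℕ.* suc m) (suc m ℕ.* suc N) 1 (suc N) (s≤s z≤n) (s≤s z≤n) cross)) ⟩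
    frac 1 (suc N) + B ∎
    where
    open ≤-Reasoning
    w = frac 1 (suc m)
    q = Q₁-rank (suc N) m
    B≤q+B : ∀ r → B ≤ q r + B
    B≤q+B r = ≤-trans (≤-reflexive (sym (+-identityˡ B))) (+-monoˡ-≤ B (Q₁-rank-nonNeg (suc N) m r))
    cross : 1 ℕ.* suc m ℕ.* suc N ≡ 1 ℕ.* (suc m ℕ.* suc N)
    cross = ℕ.*-assoc 1 (suc m) (suc N)

  -- Q₁-rank N m r ≤ (m+1)/N, so every maximum in the average equals B.
  bellman-≡ : ∀ N m {A B} → frac (suc m) N + A ≤ B → bellman N m A B ≡ B
  bellman-≡ N m {A} {B} accept≤B = ≡.trans
    (ℚΣ.Σ-map-cong (incr (suc m)) (λ {r} _ → cong (frac 1 (suc m) *_) (p≤q⇒p⊔q≡q (≤-trans (+-monoˡ-≤ A (Q₁-rank-≤ N m r)) accept≤B))))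
    (average-const m B)

  SD-extend-ratio : ∀ {N m σ r} → IsPerm m σ → m ℕ.< N → r ∈ incr (suc m) →
    frac (SD N (extend σ r)) (SD N σ) ≡ frac 1 (suc m)
  SD-extend-ratio {N} {m} {σ} {r} perm m<N r∈ =
    frac-cross (SD N σ′) (SD N σ) 1 (suc m) (SD-positive perm (ℕ.<⇒≤ m<N)) (s≤s z≤n) (begin
      SD N σ′ ℕ.* suc m      ≡⟨ ℕ.*-comm (SD N σ′) (suc m) ⟩
      suc m ℕ.* SD N σ′      ≡⟨ SD-extend perm m<N r∈ ⟨
      SD N σ                 ≡⟨ ℕ.*-identityˡ (SD N σ) ⟨
      1 ℕ.* SD N σ           ∎)
    where
    open ≡.≡-Reasoning
    σ′ = extend σ r

  Q₁-extend : ∀ {N m σ r} → IsPerm m σ → m ℕ.< N → r ∈ incr (suc m) → Q₁ N (extend σ r) ≡ Q₁-rank N m r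
  Q₁-extend {N} {m} {σ} {r} perm m<N r∈ with r ≡ᵇ suc m in r≡ᵇ1+m
  ... | true with refl ← ≡ᵇ-true⇒≡ {r} {suc m} r≡ᵇ1+m =
    frac-cross (Win N σ′) (SD N σ′) (suc m) N (SD-positive (IsPerm-extend perm r∈) m<N) (ℕ.≤-trans (s≤s z≤n) m<N)
      (Win-extend-top perm m<N)
    where σ′ = extend σ r
  ... | false = ≡.trans (cong (λ w → frac w (SD N (extend σ r))) (Win-extend-low perm m<N r≤m)) (frac-0 (SD N (extend σ r)))
    where
    r≤m : r ℕ.≤ m
    r≤m = ℕ.≤-pred (ℕ.≤∧≢⇒< (proj₂ (∈-incr⁻ r∈)) (≡ᵇ-false⇒≢ r≡ᵇ1+m))

  continuation-suc : ∀ {N} j m f → m ℕ.+ suc f ≡ N →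
    continuation N (suc j) (suc f) ≡ bellman N m (continuation N j f) (continuation N (suc j) f)
  continuation-suc {N} j m f m+1+f≡N =
    cong (λ k → bellman N k (continuation N j f) (continuation N (suc j) f))
         (≡.trans (cong (ℕ._∸ suc f) (sym m+1+f≡N)) (ℕ.m+n∸n≡m m (suc f)))

  cont≡continuation : ∀ {N m σ} j f → IsPerm m σ → m ℕ.+ f ≡ N → cont N j f σ ≡ continuation N j f
  cont≡continuation zero f _ _ = refl
  cont≡continuation (suc j) zero _ _ = refl
  cont≡continuation {N} {m} {σ} (suc j) (suc f) perm m+f≡N with refl ← IsPerm.length≡ perm = begin
    cont N (suc j) (suc f) σ                                          ≡⟨ cong sumℚ (map-∘ {g = value} {f = extend σ} (incr (suc m))) ⟨
    sumℚ (map (value ∘ extend σ) (incr (suc m)))                      ≡⟨ ℚΣ.Σ-map-cong (incr (suc m)) step ⟩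
    bellman N m (continuation N j f) (continuation N (suc j) f)       ≡⟨ continuation-suc j m f m+f≡N ⟨
    continuation N (suc j) (suc f)                                    ∎
    where
    open ≡.≡-Reasoning
    value : List ℕ → ℚ
    value σ′ = frac (SD N σ′) (SD N σ) * V N (suc j) f σ′
    m<N : m ℕ.< N
    m<N = ≡.subst (m ℕ.<_) m+f≡N (ℕ.m<m+n m (s≤s z≤n))
    step : ∀ {r} → r ∈ incr (suc m) →
      value (extend σ r) ≡ frac 1 (suc m) * ((Q₁-rank N m r + continuation N j f) ⊔ continuation N (suc j) f)
    step r∈ = cong₂ _*_ (SD-extend-ratio perm m<N r∈)
      (cong₂ _⊔_ (cong₂ _+_ (Q₁-extend perm m<N r∈) (cont≡continuation j f perm′ 1+m+f≡N))
                 (cont≡continuation (suc j) f perm′ 1+m+f≡N))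
      where
      perm′ = IsPerm-extend perm r∈
      1+m+f≡N = ≡.trans (sym (ℕ.+-suc m f)) m+f≡N

  continuation-nonNeg : ∀ N j f → 0ℚ ≤ continuation N j f
  continuation-nonNeg N zero f = ≤-refl
  continuation-nonNeg N (suc j) zero = ≤-refl
  continuation-nonNeg N (suc j) (suc f) = bellman-nonNeg N (N ℕ.∸ suc f) (continuation N j f) (continuation-nonNeg N (suc j) f)

  continuation-mono : ∀ N j f → continuation N j f ≤ continuation N (suc j) f
  continuation-mono N zero f = continuation-nonNeg N 1 f
  continuation-mono N (suc j) zero = ≤-refl
  continuation-mono N (suc j) (suc f) = bellman-mono N (N ℕ.∸ suc f) (continuation-mono N j f) (continuation-mono N (suc j) f)

  continuation-suc-≤ : ∀ {N} j m f → m ℕ.+ suc f ≡ N → continuation N j (suc f) ≤ frac 1 N + continuation N j f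
  continuation-suc-≤ {N} zero m f _ = ≤-trans (frac-nonNeg 1 N) (≤-reflexive (sym (+-identityʳ (frac 1 N))))
  continuation-suc-≤ {N} (suc j) m f m+1+f≡N = begin
    continuation N (suc j) (suc f)                                     ≡⟨ continuation-suc j m f m+1+f≡N ⟩
    bellman N m (continuation N j f) (continuation N (suc j) f)        ≤⟨ bellman-≤ N m 1+m≤N (continuation-mono N j f) ⟩
    frac 1 N + continuation N (suc j) f                                ∎
    where
    open ≤-Reasoning
    1+m≤N = ≡.subst (suc m ℕ.≤_) m+1+f≡N (ℕ.m<m+n m ℕ.z<s)

  continuation-suc-≡ : ∀ {N} j m f → m ℕ.+ suc f ≡ N →
    frac (suc m) N + continuation N j f ≤ continuation N (suc j) f →
    continuation N (suc j) (suc f) ≡ continuation N (suc j) f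
  continuation-suc-≡ {N} j m f m+1+f≡N accept≤reject = ≡.trans (continuation-suc j m f m+1+f≡N) (bellman-≡ N m accept≤reject)

  Q₁-incr : ∀ {N m} → m ℕ.< N → Q₁ N (incr (suc m)) ≡ frac (suc m) N
  Q₁-incr {N} {m} m<N = begin
    Q₁ N (incr (suc m))              ≡⟨ cong (Q₁ N) (incr-extend m) ⟩
    Q₁ N (extend (incr m) (suc m))   ≡⟨ Q₁-extend (incr-isPerm m) m<N (∈-incr⁺ (s≤s z≤n) ℕ.≤-refl) ⟩
    Q₁-rank N m (suc m)              ≡⟨ Q₁-rank-top N m ⟩
    frac (suc m) N                   ∎
    where open ≡.≡-Reasoning

  Qᵒ-incr : ∀ {N} j k f → k ℕ.+ f ≡ N → Qᵒ N j (incr k) ≡ continuation N j f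
  Qᵒ-incr {N} j k f k+f≡N = ≡.trans (cong (λ g → cont N j g (incr k)) remaining) (cont≡continuation j f (incr-isPerm k) k+f≡N)
    where
    remaining : N ℕ.∸ length (incr k) ≡ f
    remaining = ≡.trans (cong (N ℕ.∸_) (length-incr k)) (≡.trans (cong (ℕ._∸ k) (sym k+f≡N)) (ℕ.m+n∸m≡n k f))

  Q-incr : ∀ {N} j k f → suc k ℕ.+ f ≡ N → Q N (suc j) (incr (suc k)) ≡ frac (suc k) N + continuation N j f
  Q-incr j k f k+f≡N = cong₂ _+_ (Q₁-incr (≡.subst (k ℕ.<_) k+f≡N (ℕ.m≤m+n (suc k) f))) (Qᵒ-incr j (suc k) f k+f≡N)

open Values using (frac-+-1; continuation; continuation-suc-≤; continuation-suc-≡; Q-incr; Qᵒ-incr)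
open import Data.Nat using (ℕ; zero; suc; _≤_; _∸_; s≤s)
open import Data.Nat.Properties using (m+[n∸m]≡n; +-suc)

mainTheorem7 : (N s i k : ℕ) → 2 ≤ N → 1 ≤ s → 1 ≤ i → i ≤ s → 2 ≤ k → k ≤ N →
    Negative N i (incr k) → Negative N i (incr (k ∸ 1))
mainTheorem7 N s (suc i) (suc (suc m)) _ _ _ _ _ k≤N negative = begin-strict
  Q N (suc i) (incr (suc m))                            ≡⟨ Q-incr i m (suc f) m+1+f≡N ⟩
  frac (suc m) N + continuation N i (suc f)             ≤⟨ +-monoʳ-≤ (frac (suc m) N) (continuation-suc-≤ i (suc m) f m+1+f≡N) ⟩
  frac (suc m) N + (frac 1 N + continuation N i f)      ≡⟨ +-assoc (frac (suc m) N) (frac 1 N) (continuation N i f) ⟨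
  frac (suc m) N + frac 1 N + continuation N i f        ≡⟨ cong (_+ continuation N i f) (frac-+-1 (suc m) N) ⟩
  frac (suc (suc m)) N + continuation N i f             <⟨ accept<reject ⟩
  continuation N (suc i) f                              ≡⟨ continuation-suc-≡ i (suc m) f m+1+f≡N (<⇒≤ accept<reject) ⟨
  continuation N (suc i) (suc f)                        ≡⟨ Qᵒ-incr (suc i) (suc m) (suc f) m+1+f≡N ⟨
  Qᵒ N (suc i) (incr (suc m))                           ∎
  where
  open import Data.Rational using (_+_; _<_)
  open import Data.Rational.Properties using (module ≤-Reasoning; +-monoʳ-≤; +-assoc; <⇒≤)
  open ≤-Reasoning
  f = N ∸ suc (suc m)
  k+f≡N = m+[n∸m]≡n k≤N
  m+1+f≡N = ≡.trans (+-suc (suc m) f) k+f≡N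
  accept<reject : frac (suc (suc m)) N + continuation N i f < continuation N (suc i) f
  accept<reject = ≡.subst₂ _<_ (Q-incr i (suc m) f k+f≡N) (Qᵒ-incr (suc i) (suc (suc m)) f k+f≡N) negative
mainTheorem7 _ _ _ (suc zero) _ _ _ _ (s≤s ()) _ _
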